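{- For every function $f$ from the set of all hypergraphs to the set of all graphs, there exists a hypergraph $\mathcal{H}$ such that $tr(\mathcal{H})\neq\mathcal{D}(f(\mathcal{H}))$.
   Context: All graphs are finite, simple and undirected. A hypergraph $\mathcal{H}$ is a pair $(V(\mathcal{H}),\mathcal{E}(\mathcal{H}))$ with $V(\mathcal{H})$ finite and $\mathcal{E}(\mathcal{H})\subseteq 2^{V(\mathcal{H})}\setminus\{\emptyset\}$. A transversal of $\mathcal{H}$ is a subset of $V(\mathcal{H})$ meeting every hyperedge; $tr(\mathcal{H})$ denotes the set of inclusion-minimal transversals. For a graph $G$, a dominating set is a set $D\subseteq V(G)$ such that every vertex is in $D$ or has a neighbour in $D$; $\mathcal{D}(G)$ denotes the set of inclusion-minimal dominating sets of $G$. -}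

module Defs where

open import Data.Nat using (ℕ)
open import Data.List using (List)
open import Data.List.Membership.Propositional using (_∈_)
open import Data.Product using (Σ; ∃; _×_)
open import Data.Sum using (_⊎_)
open import Relation.Binary.PropositionalEquality using (_≡_; _≢_)

-- Vertices are labelled by natural numbers; a finite set of vertices is
-- given by a list (read extensionally, via membership).

_⊆_ : List ℕ → List ℕ → Set
A ⊆ B = ∀ x → x ∈ A → x ∈ B

record Hypergraph : Set where
  field
    V        : List ℕ
    E        : List (List ℕ)
    nonempty : ∀ e → e ∈ E → ∃ λ x → x ∈ e
    inV      : ∀ e → e ∈ E → e ⊆ V
open Hypergraph public

-- A finite simple graph: finite vertex set, edges as unordered pairs
-- (listed in either orientation), endpoints in V, no loops.
record Graph : Set where
  field
    VG     : List ℕ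
    EG     : List (ℕ × ℕ)
    ends   : ∀ u v → (u Data.Product., v) ∈ EG → u ∈ VG × v ∈ VG
    noLoop : ∀ u v → (u Data.Product., v) ∈ EG → u ≢ v
open Graph public

Adj : Graph → ℕ → ℕ → Set
Adj G u v = (u Data.Product., v) ∈ EG G ⊎ (v Data.Product., u) ∈ EG G

IsTransversal : Hypergraph → List ℕ → Set
IsTransversal H T = T ⊆ V H × (∀ e → e ∈ E H → ∃ λ x → x ∈ e × x ∈ T)

InTr : Hypergraph → List ℕ → Set
InTr H T = IsTransversal H T × (∀ T' → T' ⊆ T → IsTransversal H T' → T ⊆ T')

IsDominating : Graph → List ℕ → Set
IsDominating G D = D ⊆ VG G ×
  (∀ v → v ∈ VG G → v ∈ D ⊎ (∃ λ u → u ∈ D × Adj G v u))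

InDom : Graph → List ℕ → Set
InDom G D = IsDominating G D × (∀ D' → D' ⊆ D → IsDominating G D' → D ⊆ D')

SameFamily : Hypergraph → Graph → Set
SameFamily H G = ∀ S → (InTr H S → InDom G S) × (InDom G S → InTr H S)

module Submission where

-- Suppose 𝒟(G) = tr(H). For a hyperedge e, the set V(G) ∖ e cannot dominate G: a minimal
-- dominating subset of it would be a minimal transversal of H missing e. Take for H the
-- 4-cycle with edges 13, 14, 23, 24, whose minimal transversals are {1,2} and {3,4}. Both
-- dominate G, so every vertex has a neighbour on the opposite side, and a short case split
-- finds an edge {a,b} with a and b each adjacent to a vertex outside {a,b}; then
-- V(G) ∖ {a,b} dominates G.

open import Defs
open import Data.Empty using (⊥; ⊥-elim)
open import Data.List using (List; []; _∷_; [_]; length; filter)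
open import Data.List.Membership.Propositional using (_∈_; _∉_; find; lose)
open import Data.List.Membership.Propositional.Properties using (∈-filter⁺; ∈-filter⁻)
open import Data.Nat using (ℕ; _<_; _≟_)
open import Data.List.Membership.DecPropositional _≟_ using (_∈?_)
open import Data.List.Properties using (filter-notAll)
open import Data.List.Relation.Unary.All as All using (all?)
open import Data.List.Relation.Unary.Any using (here; there; any?)
open import Data.Nat.Induction using (<-wellFounded)
open import Data.Product using (∃; _×_; _,_; proj₁; proj₂; uncurry)
open import Data.Product.Properties using (≡-dec)
open import Data.Sum using (_⊎_; inj₁; inj₂)
open import Induction.WellFounded using (Acc; acc)
open import Relation.Binary.PropositionalEquality using (_≡_; refl)
open import Relation.Nullary using (¬_; Dec; yes; no; ¬?)
open import Relation.Nullary.Decidable using (map′; _×-dec_; _⊎-dec_; from-yes; False; toWitnessFalse; decidable-stable)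
open import Relation.Unary using (Decidable)

import Data.List.Membership.DecPropositional as PairMembership

infixl 25 _∖_

_∖_ : List ℕ → List ℕ → List ℕ
A ∖ B = filter (λ x → ¬? (x ∈? B)) A

module _ {A B : List ℕ} {x : ℕ} where

  ∈-∖⁺ : x ∈ A → x ∉ B → x ∈ A ∖ B
  ∈-∖⁺ = ∈-filter⁺ (λ y → ¬? (y ∈? B))

  ∈-∖⁻ : x ∈ A ∖ B → x ∈ A × x ∉ B
  ∈-∖⁻ = ∈-filter⁻ (λ y → ¬? (y ∈? B))

  length-∖-< : x ∈ A → x ∈ B → length (A ∖ B) < length A
  length-∖-< x∈A x∈B = filter-notAll (λ y → ¬? (y ∈? B)) A (lose x∈A (λ x∉B → x∉B x∈B))

∖-⊆ : ∀ A B → A ∖ B ⊆ A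
∖-⊆ A B x x∈A∖B = proj₁ (∈-∖⁻ x∈A∖B)

⊆-refl : ∀ {A} → A ⊆ A
⊆-refl x x∈A = x∈A

⊆-trans : ∀ {A B C} → A ⊆ B → B ⊆ C → A ⊆ C
⊆-trans A⊆B B⊆C x x∈A = B⊆C x (A⊆B x x∈A)

module _ {X : Set} {Q : X → Set} (Q? : Decidable Q) where

  ∃∈? : ∀ xs → Dec (∃ λ x → x ∈ xs × Q x)
  ∃∈? xs = map′ find (λ (x , x∈xs , q) → lose x∈xs q) (any? Q? xs)

  ∀∈? : ∀ xs → Dec (∀ x → x ∈ xs → Q x)
  ∀∈? xs = map′ (λ all x x∈xs → All.lookup all x∈xs) (λ q → All.tabulate (q _)) (all? Q? xs)

_⊆?_ : ∀ A B → Dec (A ⊆ B)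
A ⊆? B = ∀∈? (_∈? B) A

Minimal : (List ℕ → Set) → List ℕ → Set
Minimal P D = P D × (∀ D' → D' ⊆ D → P D' → D ⊆ D')

-- Under this closure, minimality of a set can be tested by deleting single elements.
IntervalClosed : (List ℕ → Set) → Set
IntervalClosed P = ∀ {A B C} → A ⊆ B → B ⊆ C → P A → P C → P B

module _ {P : List ℕ → Set} (P? : Decidable P) (closed : IntervalClosed P) where

  minimal-if-no-deletion : ∀ {C} → P C → (∀ x → x ∈ C → ¬ P (C ∖ [ x ])) → Minimal P C
  minimal-if-no-deletion {C} pC none = pC , λ D' D'⊆C pD' x x∈C →
    decidable-stable (x ∈? D') λ x∉D' →
      none x x∈C (closed (D'⊆C∖x x∉D' D'⊆C) (∖-⊆ C [ x ]) pD' pC)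
    where
    D'⊆C∖x : ∀ {D' x} → x ∉ D' → D' ⊆ C → D' ⊆ C ∖ [ x ]
    D'⊆C∖x x∉D' D'⊆C y y∈D' = ∈-∖⁺ (D'⊆C y y∈D') λ { (here refl) → x∉D' y∈D' }

  minimal-no-deletion : ∀ {C} → Minimal P C → ∀ x → x ∈ C → ¬ P (C ∖ [ x ])
  minimal-no-deletion {C} (_ , minC) x x∈C pC∖x =
    proj₂ (∈-∖⁻ {C} {[ x ]} (minC (C ∖ [ x ]) (∖-⊆ C [ x ]) pC∖x x x∈C)) (here refl)

  minimal? : Decidable (Minimal P)
  minimal? C = map′ (uncurry minimal-if-no-deletion)
                    (λ minC → proj₁ minC , minimal-no-deletion minC)
                    (P? C ×-dec ∀∈? (λ x → ¬? (P? (C ∖ [ x ]))) C)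

  minimal-subset : ∀ C → P C → ∃ λ D → D ⊆ C × Minimal P D
  minimal-subset C = go C (<-wellFounded (length C))
    where
    go : ∀ C → Acc _<_ (length C) → P C → ∃ λ D → D ⊆ C × Minimal P D
    go C (acc smaller) pC with ∃∈? (λ x → P? (C ∖ [ x ])) C
    ... | yes (x , x∈C , pC∖x) =
      let D , D⊆C∖x , minD = go (C ∖ [ x ]) (smaller (length-∖-< x∈C (here refl))) pC∖x
      in  D , ⊆-trans D⊆C∖x (∖-⊆ C [ x ]) , minD
    ... | no none = C , ⊆-refl , minimal-if-no-deletion pC λ x x∈C p → none (x , x∈C , p)

module _ (G : Graph) where

  Adj-sym : ∀ {u v} → Adj G u v → Adj G v u
  Adj-sym (inj₁ uv) = inj₂ uv
  Adj-sym (inj₂ vu) = inj₁ vu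

  Adj⇒∈ : ∀ {u v} → Adj G u v → v ∈ VG G
  Adj⇒∈ (inj₁ uv) = proj₂ (ends G _ _ uv)
  Adj⇒∈ (inj₂ vu) = proj₁ (ends G _ _ vu)

  Adj? : ∀ u v → Dec (Adj G u v)
  Adj? u v = (u , v) ∈ₑ? EG G ⊎-dec (v , u) ∈ₑ? EG G
    where open PairMembership (≡-dec _≟_ _≟_) using () renaming (_∈?_ to _∈ₑ?_)

  IsDominating? : Decidable (IsDominating G)
  IsDominating? D = D ⊆? VG G ×-dec ∀∈? (λ v → v ∈? D ⊎-dec ∃∈? (Adj? v) D) (VG G)

  IsDominating-closed : IntervalClosed (IsDominating G)
  IsDominating-closed A⊆B B⊆C (_ , dominated) (C⊆V , _) =
    ⊆-trans B⊆C C⊆V , λ v v∈V → enlarge (dominated v v∈V)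
    where
    enlarge : ∀ {v} → v ∈ _ ⊎ (∃ λ u → u ∈ _ × Adj G v u) → v ∈ _ ⊎ (∃ λ u → u ∈ _ × Adj G v u)
    enlarge (inj₁ v∈A) = inj₁ (A⊆B _ v∈A)
    enlarge (inj₂ (u , u∈A , vu)) = inj₂ (u , A⊆B u u∈A , vu)

  adjacent-to-pair : ∀ {p q v} → IsDominating G (p ∷ q ∷ []) → v ∈ VG G → v ∉ p ∷ q ∷ [] →
                     Adj G v p ⊎ Adj G v q
  adjacent-to-pair (_ , dominated) v∈V v∉pq with dominated _ v∈V
  ... | inj₁ v∈pq                         = ⊥-elim (v∉pq v∈pq)
  ... | inj₂ (_ , here refl , vp)         = inj₁ vp
  ... | inj₂ (_ , there (here refl) , vq) = inj₂ vq

  complement-dominating : ∀ e → (∀ v → v ∈ e → ∃ λ u → u ∉ e × Adj G v u) → IsDominating G (VG G ∖ e)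
  complement-dominating e outside = ∖-⊆ (VG G) e , λ v v∈V → dominated v v∈V (v ∈? e)
    where
    dominated : ∀ v → v ∈ VG G → Dec (v ∈ e) → v ∈ VG G ∖ e ⊎ (∃ λ u → u ∈ VG G ∖ e × Adj G v u)
    dominated v v∈V (no v∉e)  = inj₁ (∈-∖⁺ v∈V v∉e)
    dominated v v∈V (yes v∈e) =
      let u , u∉e , vu = outside v v∈e in inj₂ (u , ∈-∖⁺ (Adj⇒∈ vu) u∉e , vu)

module _ (H : Hypergraph) where

  IsTransversal? : Decidable (IsTransversal H)
  IsTransversal? T = T ⊆? V H ×-dec ∀∈? (λ e → ∃∈? (_∈? T) e) (E H)

  IsTransversal-closed : IntervalClosed (IsTransversal H)
  IsTransversal-closed A⊆B B⊆C (_ , hits) (C⊆V , _) =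
    ⊆-trans B⊆C C⊆V , λ e e∈E → let x , x∈e , x∈A = hits e e∈E in x , x∈e , A⊆B x x∈A

  InTr? : Decidable (InTr H)
  InTr? = minimal? IsTransversal? IsTransversal-closed

complement-of-hyperedge-not-dominating : ∀ H G {e} → SameFamily H G → e ∈ E H → ¬ IsDominating G (VG G ∖ e)
complement-of-hyperedge-not-dominating H G {e} same e∈E dom =
  let D , D⊆V∖e , minD = minimal-subset (IsDominating? G) (IsDominating-closed G) _ dom
      x , x∈e , x∈D    = proj₂ (proj₁ (proj₂ (same D) minD)) e e∈E
  in  proj₂ (∈-∖⁻ {VG G} (D⊆V∖e x x∈D)) x∈e

fourCycle : Hypergraph
fourCycle = record
  { V        = vertices
  ; E        = edges
  ; nonempty = edges-nonempty
  ; inV      = from-yes (∀∈? (_⊆? vertices) edges)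
  }
  where
  vertices : List ℕ
  vertices = 1 ∷ 2 ∷ 3 ∷ 4 ∷ []

  edges : List (List ℕ)
  edges = (1 ∷ 3 ∷ []) ∷ (1 ∷ 4 ∷ []) ∷ (2 ∷ 3 ∷ []) ∷ (2 ∷ 4 ∷ []) ∷ []

  edges-nonempty : ∀ e → e ∈ edges → ∃ λ x → x ∈ e
  edges-nonempty _ (here refl)                         = _ , here refl
  edges-nonempty _ (there (here refl))                 = _ , here refl
  edges-nonempty _ (there (there (here refl)))         = _ , here refl
  edges-nonempty _ (there (there (there (here refl)))) = _ , here refl

¬SameFamily-fourCycle : ∀ G → ¬ SameFamily fourCycle G
¬SameFamily-fourCycle G same =
  cases (neighbour dom34 (V12 1 (here refl))) (neighbour dom34 (V12 2 (there (here refl))))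
  where
  dominating : ∀ {T} → InTr fourCycle T → IsDominating G T
  dominating minT = proj₁ (proj₁ (same _) minT)

  dom12 : IsDominating G (1 ∷ 2 ∷ [])
  dom12 = dominating (from-yes (InTr? fourCycle (1 ∷ 2 ∷ [])))

  dom34 : IsDominating G (3 ∷ 4 ∷ [])
  dom34 = dominating (from-yes (InTr? fourCycle (3 ∷ 4 ∷ [])))

  V12 : (1 ∷ 2 ∷ []) ⊆ VG G
  V12 = proj₁ dom12

  V34 : (3 ∷ 4 ∷ []) ⊆ VG G
  V34 = proj₁ dom34

  neighbour : ∀ {p q v} → IsDominating G (p ∷ q ∷ []) → v ∈ VG G → {False (v ∈? p ∷ q ∷ [])} →
              Adj G v p ⊎ Adj G v q
  neighbour dom v∈V {v∉pq} = adjacent-to-pair G dom v∈V (toWitnessFalse v∉pq)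

  excluded : ∀ {a b c d} → a ∷ b ∷ [] ∈ E fourCycle → Adj G a c → Adj G b d →
             {False (c ∈? a ∷ b ∷ [])} → {False (d ∈? a ∷ b ∷ [])} → ⊥
  excluded ab∈E ac bd {c∉ab} {d∉ab} =
    complement-of-hyperedge-not-dominating fourCycle G same ab∈E (complement-dominating G _ λ where
      _ (here refl)         → _ , toWitnessFalse c∉ab , ac
      _ (there (here refl)) → _ , toWitnessFalse d∉ab , bd)

  13∈E : 1 ∷ 3 ∷ [] ∈ E fourCycle
  13∈E = here refl

  14∈E : 1 ∷ 4 ∷ [] ∈ E fourCycle
  14∈E = there (here refl)

  23∈E : 2 ∷ 3 ∷ [] ∈ E fourCycle
  23∈E = there (there (here refl))

  24∈E : 2 ∷ 4 ∷ [] ∈ E fourCycle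
  24∈E = there (there (there (here refl)))

  cases : Adj G 1 3 ⊎ Adj G 1 4 → Adj G 2 3 ⊎ Adj G 2 4 → ⊥
  cases (inj₁ 1~3) (inj₂ 2~4) = excluded 14∈E 1~3 (Adj-sym G 2~4)
  cases (inj₂ 1~4) (inj₁ 2~3) = excluded 13∈E 1~4 (Adj-sym G 2~3)
  cases (inj₁ 1~3) (inj₁ 2~3) with neighbour dom12 (V34 4 (there (here refl)))
  ... | inj₁ 4~1 = excluded 24∈E 2~3 4~1
  ... | inj₂ 4~2 = excluded 14∈E 1~3 4~2
  cases (inj₂ 1~4) (inj₂ 2~4) with neighbour dom12 (V34 3 (here refl))
  ... | inj₁ 3~1 = excluded 23∈E 2~4 3~1
  ... | inj₂ 3~2 = excluded 13∈E 1~4 3~2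

proposition3p1 : (f : Hypergraph → Graph) → ∃ λ H → ¬ SameFamily H (f H)
proposition3p1 f = fourCycle , ¬SameFamily-fourCycle (f fourCycle)
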